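{- Let $\omega$ be a permutation of $[n]$, and let $\mathcal{C}^0$ be the collection consisting of $\emptyset$ together with all sets $I^k_\omega\cap[j..n]$ for $1\le k\le n$, $1\le j\le\omega^{ -1}(k)$. Let $X\subset[n]$ satisfy $X\notin\mathcal{C}^0$ and be weakly separated from every member of $\mathcal{C}^0$; let $k=|X|$ and $Y=I^k_\omega$. Then neither $Y\lessdot X$ nor $Y\rhd X$ holds.
   Context: $[j..n]=\{j,\dots,n\}$, $I^k_\omega=\{i:\omega(i)\le k\}$, $I^0_\omega=\emptyset$. For $A,B\subseteq[n]$ write $A\lessdot B$ if $B-A\neq\emptyset$ and $i<j$ for all $i\in A-B$, $j\in B-A$. Write $A\rhd B$ if both $A-B$ and $B-A$ are nonempty and $B-A$ is a disjoint union $B'\sqcup B''$ of nonempty sets with $b'<a<b''$ for all $b'\in B'$, $a\in A-B$, $b''\in B''$. Sets $A,B$ are weakly separated if $A\lessdot B$, or $B\lessdot A$, or ($A\rhd B$ and $|A|\ge|B|$), or ($B\rhd A$ and $|B|\ge|A|$), or $A=B$. -}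

module Defs where

open import Data.Nat using (ℕ; suc; _≤_; _<_; _≥_; _≤?_)
open import Data.Fin using (Fin; toℕ)
open import Data.Fin.Subset using (Subset; _∈_; _∉_; _∩_; _∪_; _─_; ∣_∣; Nonempty; ⊥)
open import Data.Fin.Permutation using (Permutation′; _⟨$⟩ʳ_; _⟨$⟩ˡ_)
open import Data.Vec using (tabulate)
open import Data.Product using (Σ; ∃; _×_)
open import Data.Sum using (_⊎_)
open import Relation.Binary.PropositionalEquality using (_≡_)
open import Relation.Nullary.Decidable using (⌊_⌋)

-- Convention: Fin n element i represents the number (toℕ i + 1) ∈ [n].
-- The order on [n] is the order on toℕ.

I : ∀ {n} → ℕ → Permutation′ n → Subset n
I k ω = tabulate (λ i → ⌊ suc (toℕ (ω ⟨$⟩ʳ i)) ≤? k ⌋)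

interval : ∀ {n} → ℕ → Subset n
interval j = tabulate (λ i → ⌊ j ≤? suc (toℕ i) ⌋)

_⋖_ : ∀ {n} → Subset n → Subset n → Set
A ⋖ B = Nonempty (B ─ A) ×
        (∀ i j → i ∈ (A ─ B) → j ∈ (B ─ A) → toℕ i < toℕ j)

_▷_ : ∀ {n} → Subset n → Subset n → Set
_▷_ {n} A B = Nonempty (A ─ B) × Nonempty (B ─ A) ×
  Σ (Subset n) λ B′ → Σ (Subset n) λ B″ →
    (B′ ∪ B″ ≡ B ─ A) × (B′ ∩ B″ ≡ ⊥) × Nonempty B′ × Nonempty B″ ×
    (∀ b′ a b″ → b′ ∈ B′ → a ∈ (A ─ B) → b″ ∈ B″ →
       (toℕ b′ < toℕ a) × (toℕ a < toℕ b″))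

WeaklySeparated : ∀ {n} → Subset n → Subset n → Set
WeaklySeparated A B =
  (A ⋖ B) ⊎ (B ⋖ A) ⊎ ((A ▷ B) × ∣ A ∣ ≥ ∣ B ∣) ⊎ ((B ▷ A) × ∣ B ∣ ≥ ∣ A ∣) ⊎ (A ≡ B)

-- Membership in 𝒞⁰: ∅, or I^k_ω ∩ [j..n] with 1 ≤ k ≤ n, 1 ≤ j ≤ ω⁻¹(k).
-- k is represented by kf : Fin n with k = suc (toℕ kf); ω⁻¹(k) = suc (toℕ (ω ⟨$⟩ˡ kf)).
InC0 : ∀ {n} → Permutation′ n → Subset n → Set
InC0 {n} ω X = (X ≡ ⊥) ⊎
  Σ (Fin n) λ kf → Σ ℕ λ j →
    (1 ≤ j) × (j ≤ suc (toℕ (ω ⟨$⟩ˡ kf))) × (X ≡ I (suc (toℕ kf)) ω ∩ interval j)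

module Submission where

-- Lemma 2.2.  Write rank x = ω(x) − 1 and Y = I^k_ω with k = |X|; since ω is a
-- permutation, |Y| = k = |X|.  Only two kinds of members of 𝒞⁰ are needed:
-- truncated levels I^{ω(b)}_ω ∩ [j..n], and among them the hooks
-- H_c = I^{ω(c)}_ω ∩ [c..n] (the elements at or after c of rank at most rank c).
--
-- Two obstructions to weak separation of X from a set C are proved first:
--   (a) C ─ X = {c} while X ─ C has elements before and after c;
--   (b) |X| < |C| and X ─ C has an element between two elements of C ─ X.
-- If c ∉ X is the last non-member of X of rank ≤ rank c, then H_c ─ X = {c},
-- so (a) applies to H_c as soon as X has members on both sides of c outside H_c.
--
-- Y ▷ X: c = the last element of Y ─ X lies between the two blocks of X ─ Y: (a).
-- Y ⋖ X: let b be the member of X of largest rank K and c the last non-member of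
-- X of rank < K.  Obstruction (b) for the level I^{ω(c)}_ω forces c before b.
-- Then X has a member before c, and (a) applies to H_c, or else
-- X = I^{K+1}_ω ∩ [c+2..n] ∈ 𝒞⁰ (and X = I^{K+1}_ω ∈ 𝒞⁰ if there is no such c).

open import Defs
open import Data.Nat using (ℕ; zero; suc; _+_; _≤_; _<_; z≤n; s≤s; _≤?_; _<?_)
open import Data.Nat.Properties using (≤-refl; ≤-trans; ≤-antisym; ≤∧≢⇒<; <⇒≤; <⇒≱; <⇒≢; ≮⇒≥; ≰⇒>; ≤∧≮⇒≡; <-cmp; <-asym; ≤-<-trans; <-≤-trans; ≤-pred; +-suc; +-cancelˡ-≡; +-cancelʳ-<; +-monoʳ-<; +-0-commutativeMonoid)
open import Data.Bool using (Bool; true; false)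
open import Data.Bool.Properties using (T-≡)
open import Data.Fin using (Fin; zero; suc; toℕ)
open import Data.Fin.Properties using (toℕ-injective; toℕ<n; any?)
open import Data.Fin.Subset using (Subset; _∈_; _∉_; _⊆_; _∩_; _∪_; _─_; ⁅_⁆; ∣_∣; Nonempty; inside; outside)
open import Data.Fin.Subset.Properties using (_∈?_; nonempty?; Empty-unique; ∣⊥∣≡0; ∣p∣≤n; ∣⁅x⁆∣≡1; x∈⁅x⁆; p⊆q⇒∣p∣≤∣q∣; x∈p⇒∣p-x∣<∣p∣; x∈⁅y⁆⇒x≡y; x∈p∧x≢y⇒x∈p-y; p─q⊆p; x∈p∧x∉q⇒x∈p─q; x∈p∩q⁺; x∈p∩q⁻; x∈p∪q⁺; x∈p∪q⁻; ⊆-antisym)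
open import Data.Fin.Permutation using (Permutation′; _⟨$⟩ʳ_; _⟨$⟩ˡ_; inverseˡ)
open import Data.Vec using ([]; _∷_; tabulate; there)
open import Data.Vec.Properties using (lookup∘tabulate; []=⇒lookup; lookup⇒[]=)
open import Data.Product using (_×_; _,_; Σ; proj₁; proj₂)
open import Data.Sum using (inj₁; inj₂)
open import Data.Empty using () renaming (⊥ to False)
open import Function using (_∘_)
open import Function.Bundles using (Equivalence)
open import Relation.Binary using (tri<; tri≈; tri>)
open import Relation.Nullary using (¬_; Dec; yes; no; contradiction)
open import Relation.Nullary.Decidable using (⌊_⌋; toWitness; fromWitness; ¬?; _×-dec_)
open import Relation.Binary.PropositionalEquality using (_≡_; _≢_; refl; sym; trans; cong; subst; module ≡-Reasoning)
open import Algebra.Properties.CommutativeMonoid.Sum +-0-commutativeMonoid using (sum; sum-permute; sum-cong-≗)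

module _ {n} {P : Fin n → Set} (P? : ∀ i → Dec (P i)) where

  ∈tabulate⁻ : ∀ {i} → i ∈ tabulate (λ j → ⌊ P? j ⌋) → P i
  ∈tabulate⁻ {i} i∈ =
    toWitness (Equivalence.from T-≡ (trans (sym (lookup∘tabulate _ i)) ([]=⇒lookup i∈)))

  ∈tabulate⁺ : ∀ {i} → P i → i ∈ tabulate (λ j → ⌊ P? j ⌋)
  ∈tabulate⁺ {i} p =
    lookup⇒[]= i _ (trans (lookup∘tabulate _ i) (Equivalence.to T-≡ (fromWitness p)))

∈─⁻ : ∀ {n} (p q : Subset n) {x} → x ∈ p ─ q → x ∈ p × x ∉ q
∈─⁻ p q x∈ = p─q⊆p p q x∈ , not-in-q p q x∈
  where
  not-in-q : ∀ {n} (p q : Subset n) {x} → x ∈ p ─ q → x ∉ q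
  not-in-q (_ ∷ p) (inside ∷ q) (there x∈) (there x∈q) = not-in-q p q x∈ x∈q
  not-in-q (_ ∷ p) (outside ∷ q) (there x∈) (there x∈q) = not-in-q p q x∈ x∈q

toℕ-antisym : ∀ {n} {x y : Fin n} → toℕ x ≤ toℕ y → toℕ y ≤ toℕ x → x ≡ y
toℕ-antisym x≤y y≤x = toℕ-injective (≤-antisym x≤y y≤x)

maximise : ∀ {n} {P : Fin n → Set} → (∀ x → Dec (P x)) → (f : Fin n → ℕ) →
           Σ (Fin n) P → Σ (Fin n) λ m → P m × (∀ y → P y → f y ≤ f m)
maximise {suc n} {P} P? f (x , px) with any? (P? ∘ suc)
... | no none = zero , only-zero x px , λ { zero _ → ≤-refl ; (suc y) py → contradiction (y , py) none }
  where
  only-zero : ∀ x → P x → P zero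
  only-zero zero    p = p
  only-zero (suc y) p = contradiction (y , p) none
... | yes some with maximise (P? ∘ suc) (f ∘ suc) some | P? zero
...   | m , pm , m-max | no ¬p0 =
        suc m , pm , λ { zero p0 → contradiction p0 ¬p0 ; (suc y) py → m-max y py }
...   | m , pm , m-max | yes p0 with f zero ≤? f (suc m)
...     | yes le = suc m , pm , λ { zero _ → le ; (suc y) py → m-max y py }
...     | no gt  = zero , p0 , λ { zero _ → ≤-refl ; (suc y) py → ≤-trans (m-max y py) (<⇒≤ (≰⇒> gt)) }

∈⇒size-pos : ∀ {n} {p : Subset n} {x} → x ∈ p → 0 < ∣ p ∣
∈⇒size-pos {x = x} x∈ = subst (_≤ _) (∣⁅x⁆∣≡1 x) (p⊆q⇒∣p∣≤∣q∣ ⁅x⁆⊆p)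
  where
  ⁅x⁆⊆p : ⁅ x ⁆ ⊆ _
  ⁅x⁆⊆p y∈ = subst (_∈ _) (sym (x∈⁅y⁆⇒x≡y x y∈)) x∈

size-pos⇒nonempty : ∀ {n} (p : Subset n) → 0 < ∣ p ∣ → Nonempty p
size-pos⇒nonempty {n} p pos with nonempty? p
... | yes ne   = ne
... | no empty = contradiction (trans (cong ∣_∣ (Empty-unique empty)) (∣⊥∣≡0 n)) (<⇒≢ pos ∘ sym)

∣p∣+∣q─p∣≡∣q∣+∣p─q∣ : ∀ {n} (p q : Subset n) → ∣ p ∣ + ∣ q ─ p ∣ ≡ ∣ q ∣ + ∣ p ─ q ∣
∣p∣+∣q─p∣≡∣q∣+∣p─q∣ []            []            = refl
∣p∣+∣q─p∣≡∣q∣+∣p─q∣ (inside ∷ p)  (inside ∷ q)  = cong suc (∣p∣+∣q─p∣≡∣q∣+∣p─q∣ p q)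
∣p∣+∣q─p∣≡∣q∣+∣p─q∣ (inside ∷ p)  (outside ∷ q) = trans (cong suc (∣p∣+∣q─p∣≡∣q∣+∣p─q∣ p q)) (sym (+-suc _ _))
∣p∣+∣q─p∣≡∣q∣+∣p─q∣ (outside ∷ p) (inside ∷ q)  = trans (+-suc _ _) (cong suc (∣p∣+∣q─p∣≡∣q∣+∣p─q∣ p q))
∣p∣+∣q─p∣≡∣q∣+∣p─q∣ (outside ∷ p) (outside ∷ q) = ∣p∣+∣q─p∣≡∣q∣+∣p─q∣ p q

smaller-difference⇒smaller : ∀ {n} (X C : Subset n) → ∣ C ─ X ∣ < ∣ X ─ C ∣ → ∣ C ∣ < ∣ X ∣
smaller-difference⇒smaller X C lt = +-cancelʳ-< (∣ X ─ C ∣) (∣ C ∣) (∣ X ∣)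
  (subst (_< ∣ X ∣ + ∣ X ─ C ∣) (∣p∣+∣q─p∣≡∣q∣+∣p─q∣ X C) (+-monoʳ-< ∣ X ∣ lt))

equal-size⇒other-difference : ∀ {n} (p q : Subset n) → ∣ p ∣ ≡ ∣ q ∣ → Nonempty (p ─ q) → Nonempty (q ─ p)
equal-size⇒other-difference p q p≡q (x , x∈) = size-pos⇒nonempty (q ─ p) (subst (0 <_) (sym balance) (∈⇒size-pos x∈))
  where
  balance : ∣ q ─ p ∣ ≡ ∣ p ─ q ∣
  balance = +-cancelˡ-≡ ∣ p ∣ _ _ (trans (∣p∣+∣q─p∣≡∣q∣+∣p─q∣ p q) (cong (_+ ∣ p ─ q ∣) (sym p≡q)))

indicator : Bool → ℕ
indicator true  = 1
indicator false = 0

∣tabulate∣ : ∀ {n} (g : Fin n → Bool) → ∣ tabulate g ∣ ≡ sum (indicator ∘ g)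
∣tabulate∣ {zero}  g = refl
∣tabulate∣ {suc n} g with g zero
... | true  = cong suc (∣tabulate∣ (g ∘ suc))
... | false = ∣tabulate∣ (g ∘ suc)

≤?-suc : ∀ a m → ⌊ suc a ≤? suc m ⌋ ≡ ⌊ a ≤? m ⌋
≤?-suc a m with a ≤? m | suc a ≤? suc m
... | yes _   | yes _     = refl
... | no _    | no _      = refl
... | yes a≤m | no 1+a≰m  = contradiction (s≤s a≤m) 1+a≰m
... | no a≰m  | yes 1+a≤m = contradiction (≤-pred 1+a≤m) a≰m

count-initial : ∀ n m → m ≤ n → sum {n} (λ i → indicator ⌊ suc (toℕ i) ≤? m ⌋) ≡ m
count-initial zero    zero    _         = refl
count-initial (suc n) zero    _         = count-initial n zero z≤n
count-initial (suc n) (suc m) (s≤s m≤n) = cong suc (trans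
  (sum-cong-≗ {n} (λ i → cong indicator (≤?-suc (suc (toℕ i)) m))) (count-initial n m m≤n))

-- |I^m_ω| = m for m ≤ n, because ω permutes the values 1, …, n.
∣I∣ : ∀ {n} m (ω : Permutation′ n) → m ≤ n → ∣ I m ω ∣ ≡ m
∣I∣ {n} m ω m≤n = begin
  ∣ I m ω ∣                ≡⟨ ∣tabulate∣ {n} _ ⟩
  sum (λ i → f (ω ⟨$⟩ʳ i)) ≡⟨ sum-permute f ω ⟨
  sum f                    ≡⟨ count-initial n m m≤n ⟩
  m                        ∎
  where
  open ≡-Reasoning
  f : Fin n → ℕ
  f j = indicator ⌊ suc (toℕ j) ≤? m ⌋

-- The rank of x is ω(x) − 1, so that I^k_ω consists of the elements of rank < k.
rank : ∀ {n} → Permutation′ n → Fin n → ℕ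
rank ω x = toℕ (ω ⟨$⟩ʳ x)

rank-injective : ∀ {n} (ω : Permutation′ n) {x y : Fin n} → rank ω x ≡ rank ω y → x ≡ y
rank-injective ω {x} {y} eq = begin
  x                 ≡⟨ inverseˡ ω ⟨
  ω ⟨$⟩ˡ (ω ⟨$⟩ʳ x) ≡⟨ cong (ω ⟨$⟩ˡ_) (toℕ-injective eq) ⟩
  ω ⟨$⟩ˡ (ω ⟨$⟩ʳ y) ≡⟨ inverseˡ ω ⟩
  y                 ∎
  where open ≡-Reasoning

∈I⁻ : ∀ {n} k (ω : Permutation′ n) {x} → x ∈ I k ω → rank ω x < k
∈I⁻ k ω = ∈tabulate⁻ (λ i → suc (rank ω i) ≤? k)

∈I⁺ : ∀ {n} k (ω : Permutation′ n) {x} → rank ω x < k → x ∈ I k ω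
∈I⁺ k ω = ∈tabulate⁺ (λ i → suc (rank ω i) ≤? k)

∈interval⁻ : ∀ {n} j {x : Fin n} → x ∈ interval j → j ≤ suc (toℕ x)
∈interval⁻ j = ∈tabulate⁻ (λ i → j ≤? suc (toℕ i))

∈interval⁺ : ∀ {n} j {x : Fin n} → j ≤ suc (toℕ x) → x ∈ interval j
∈interval⁺ j = ∈tabulate⁺ (λ i → j ≤? suc (toℕ i))

-- [1..n] is all of [n], so untruncated levels are the case j = 1 of truncated ones.
∩interval-1 : ∀ {n} (p : Subset n) → p ∩ interval 1 ≡ p
∩interval-1 []            = refl
∩interval-1 (inside ∷ p)  = cong (inside ∷_) (∩interval-1 p)
∩interval-1 (outside ∷ p) = cong (outside ∷_) (∩interval-1 p)

level : ∀ {n} → Permutation′ n → Fin n → Subset n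
level ω b = I (suc (rank ω b)) ω

∣level∣ : ∀ {n} (ω : Permutation′ n) (b : Fin n) → ∣ level ω b ∣ ≡ suc (rank ω b)
∣level∣ ω b = ∣I∣ (suc (rank ω b)) ω (toℕ<n (ω ⟨$⟩ʳ b))

-- A level truncated to [j..n] with 1 ≤ j ≤ b + 1 belongs to 𝒞⁰ (k = ω(b), ω⁻¹(k) = b).
truncated-level∈C0 : ∀ {n} (ω : Permutation′ n) (b : Fin n) j → 1 ≤ j → j ≤ suc (toℕ b) →
                     InC0 ω (level ω b ∩ interval j)
truncated-level∈C0 ω b j 1≤j j≤b =
  inj₂ (ω ⟨$⟩ʳ b , j , 1≤j , subst (λ z → j ≤ suc (toℕ z)) (sym (inverseˡ ω)) j≤b , refl)

hook : ∀ {n} → Permutation′ n → Fin n → Subset n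
hook ω c = level ω c ∩ interval (suc (toℕ c))

hook∈C0 : ∀ {n} (ω : Permutation′ n) (c : Fin n) → InC0 ω (hook ω c)
hook∈C0 ω c = truncated-level∈C0 ω c (suc (toℕ c)) (s≤s z≤n) ≤-refl

∈hook⁻ : ∀ {n} (ω : Permutation′ n) (c : Fin n) {x} → x ∈ hook ω c → rank ω x ≤ rank ω c × toℕ c ≤ toℕ x
∈hook⁻ ω c x∈ with x∈p∩q⁻ (level ω c) (interval (suc (toℕ c))) x∈
... | x∈level , x∈interval = ≤-pred (∈I⁻ (suc (rank ω c)) ω x∈level) ,
                             ≤-pred (∈interval⁻ (suc (toℕ c)) x∈interval)

∈hook⁺ : ∀ {n} (ω : Permutation′ n) (c : Fin n) {x} → rank ω x ≤ rank ω c → toℕ c ≤ toℕ x → x ∈ hook ω c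
∈hook⁺ ω c rx≤rc c≤x = x∈p∩q⁺ (∈I⁺ (suc (rank ω c)) ω (s≤s rx≤rc) , ∈interval⁺ (suc (toℕ c)) (s≤s c≤x))

-- (a) If c is the only element of C ─ X and X ─ C has elements p < c < q, then X
-- and C are not weakly separated: neither difference precedes the other, C ─ X is
-- too small to be split around X ─ C, and |C| < |X| rules out C ▷ X.
lone-outsider-obstruction : ∀ {n} (X C : Subset n) (c p q : Fin n) →
  c ∈ C ─ X → (∀ x → x ∈ C ─ X → x ≡ c) → p ∈ X ─ C → q ∈ X ─ C →
  toℕ p < toℕ c → toℕ c < toℕ q → ¬ WeaklySeparated X C
lone-outsider-obstruction X C c p q c∈C─X lone p∈X─C q∈X─C p<c c<q = not-separated
  where
  ∣C─X∣≤1 : ∣ C ─ X ∣ ≤ 1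
  ∣C─X∣≤1 = subst (∣ C ─ X ∣ ≤_) (∣⁅x⁆∣≡1 c)
    (p⊆q⇒∣p∣≤∣q∣ (λ {x} x∈ → subst (_∈ ⁅ c ⁆) (sym (lone x x∈)) (x∈⁅x⁆ c)))
  q≢p : q ≢ p
  q≢p q≡p = <-asym p<c (subst (λ z → toℕ c < toℕ z) q≡p c<q)
  2≤∣X─C∣ : 2 ≤ ∣ X ─ C ∣
  2≤∣X─C∣ = ≤-<-trans (∈⇒size-pos (x∈p∧x≢y⇒x∈p-y q∈X─C q≢p)) (x∈p⇒∣p-x∣<∣p∣ p∈X─C)
  ∣C∣<∣X∣ : ∣ C ∣ < ∣ X ∣
  ∣C∣<∣X∣ = smaller-difference⇒smaller X C (<-≤-trans (s≤s ∣C─X∣≤1) 2≤∣X─C∣)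
  not-separated : ¬ WeaklySeparated X C
  not-separated (inj₁ (_ , X⋖C)) = <-asym (X⋖C q c q∈X─C c∈C─X) c<q
  not-separated (inj₂ (inj₁ (_ , C⋖X))) = <-asym (C⋖X c p c∈C─X p∈X─C) p<c
  not-separated (inj₂ (inj₂ (inj₁ ((_ , _ , C′ , _ , C′∪C″≡C─X , _ , (c′ , c′∈) , (c″ , c″∈) , around) , _)))) =
    <-asym p<c (subst (λ z → toℕ z < toℕ p) (lone c′ c′∈C─X) (proj₁ (around c′ p c″ c′∈ p∈X─C c″∈)))
    where
    c′∈C─X : c′ ∈ C ─ X
    c′∈C─X = subst (c′ ∈_) C′∪C″≡C─X (x∈p∪q⁺ (inj₁ c′∈))
  not-separated (inj₂ (inj₂ (inj₂ (inj₁ (_ , ∣C∣≥∣X∣))))) = <⇒≱ ∣C∣<∣X∣ ∣C∣≥∣X∣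
  not-separated (inj₂ (inj₂ (inj₂ (inj₂ X≡C)))) = proj₂ (∈─⁻ C X c∈C─X) (subst (c ∈_) (sym X≡C) (proj₁ (∈─⁻ C X c∈C─X)))

-- (b) If |X| < |C| and X ─ C has an element b between elements a < b < c of C ─ X,
-- then X and C are not weakly separated: X ─ C can be placed neither before nor
-- after C ─ X, nor split around it, and X ▷ C needs |X| ≥ |C|.
sandwich-obstruction : ∀ {n} (X C : Subset n) (a b c : Fin n) →
  a ∈ C ─ X → b ∈ X ─ C → c ∈ C ─ X → toℕ a < toℕ b → toℕ b < toℕ c →
  ∣ X ∣ < ∣ C ∣ → ¬ WeaklySeparated X C
sandwich-obstruction X C a b c a∈C─X b∈X─C c∈C─X a<b b<c ∣X∣<∣C∣ = not-separated
  where
  not-separated : ¬ WeaklySeparated X C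
  not-separated (inj₁ (_ , X⋖C)) = <-asym (X⋖C b a b∈X─C a∈C─X) a<b
  not-separated (inj₂ (inj₁ (_ , C⋖X))) = <-asym (C⋖X c b c∈C─X b∈X─C) b<c
  not-separated (inj₂ (inj₂ (inj₁ (_ , ∣X∣≥∣C∣)))) = <⇒≱ ∣X∣<∣C∣ ∣X∣≥∣C∣
  not-separated (inj₂ (inj₂ (inj₂ (inj₁ ((_ , _ , B′ , B″ , B′∪B″≡X─C , _ , (b′ , b′∈) , (b″ , b″∈) , around) , _)))))
    with x∈p∪q⁻ B′ B″ (subst (b ∈_) (sym B′∪B″≡X─C) b∈X─C)
  ... | inj₁ b∈B′ = <-asym (proj₁ (around b a b″ b∈B′ a∈C─X b″∈)) a<b
  ... | inj₂ b∈B″ = <-asym (proj₂ (around b′ c b b′∈ c∈C─X b∈B″)) b<c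
  not-separated (inj₂ (inj₂ (inj₂ (inj₂ X≡C)))) = proj₂ (∈─⁻ C X c∈C─X) (subst (c ∈_) (sym X≡C) (proj₁ (∈─⁻ C X c∈C─X)))

-- If c ∉ X comes last among the non-members of X of rank ≤ rank c, then c is the
-- only element of hook c outside X, so (a) applies to the hook of c whenever X has
-- a member p before c and a member q after c of larger rank.
hook-obstruction : ∀ {n} (ω : Permutation′ n) (X : Subset n) (c p q : Fin n) → c ∉ X →
  (∀ x → x ∉ X → rank ω x ≤ rank ω c → toℕ x ≤ toℕ c) →
  p ∈ X → toℕ p < toℕ c → q ∈ X → rank ω c < rank ω q → toℕ c < toℕ q →
  ¬ WeaklySeparated X (hook ω c)
hook-obstruction ω X c p q c∉X c-last p∈X p<c q∈X rc<rq c<q =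
  lone-outsider-obstruction X (hook ω c) c p q
    (x∈p∧x∉q⇒x∈p─q (∈hook⁺ ω c ≤-refl ≤-refl) c∉X) lone
    (x∈p∧x∉q⇒x∈p─q p∈X (λ p∈hook → <⇒≱ p<c (proj₂ (∈hook⁻ ω c p∈hook))))
    (x∈p∧x∉q⇒x∈p─q q∈X (λ q∈hook → <⇒≱ rc<rq (proj₁ (∈hook⁻ ω c q∈hook))))
    p<c c<q
  where
  lone : ∀ x → x ∈ hook ω c ─ X → x ≡ c
  lone x x∈ with ∈─⁻ (hook ω c) X x∈
  ... | x∈hook , x∉X = toℕ-antisym (c-last x x∉X (proj₁ (∈hook⁻ ω c x∈hook))) (proj₂ (∈hook⁻ ω c x∈hook))

level-shaped⇒∈C0 : ∀ {n} (ω : Permutation′ n) (X : Subset n) (b : Fin n) (j : ℕ) → b ∈ X →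
  (∀ x → x ∈ X → rank ω x ≤ rank ω b) →
  (∀ x → x ∈ X → j ≤ toℕ x) →
  (∀ x → x ∉ X → rank ω x < rank ω b → toℕ x < j) →
  InC0 ω X
level-shaped⇒∈C0 ω X b j b∈X b-top members-after others-before =
  subst (InC0 ω) (sym (⊆-antisym X⊆L L⊆X))
    (truncated-level∈C0 ω b (suc j) (s≤s z≤n) (s≤s (members-after b b∈X)))
  where
  L : Subset _
  L = level ω b ∩ interval (suc j)
  X⊆L : X ⊆ L
  X⊆L {x} x∈X = x∈p∩q⁺ (∈I⁺ _ ω (s≤s (b-top x x∈X)) , ∈interval⁺ (suc j) (s≤s (members-after x x∈X)))
  L⊆X : L ⊆ X
  L⊆X {x} x∈L with x∈p∩q⁻ (level ω b) (interval (suc j)) x∈L | x ∈? X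
  ... | _ , _ | yes x∈X = x∈X
  ... | x∈level , x∈interval | no x∉X with rank ω x <? rank ω b
  ...   | yes rx<rb = contradiction (≤-pred (∈interval⁻ (suc j) x∈interval)) (<⇒≱ (others-before x x∉X rx<rb))
  ...   | no rx≮rb  = contradiction (subst (_∈ X) (sym (rank-injective ω rx≡rb)) b∈X) x∉X
    where
    rx≡rb : rank ω x ≡ rank ω b
    rx≡rb = ≤∧≮⇒≡ (≤-pred (∈I⁻ _ ω x∈level)) rx≮rb

module _ {n} (ω : Permutation′ n) (X : Subset n)
         (separated : ∀ C → InC0 ω C → WeaklySeparated X C) where

  private
    Y : Subset n
    Y = I ∣ X ∣ ω

    ∣Y∣≡∣X∣ : ∣ Y ∣ ≡ ∣ X ∣
    ∣Y∣≡∣X∣ = ∣I∣ ∣ X ∣ ω (∣p∣≤n X)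

    ∉Y⇒high : ∀ {x} → x ∉ Y → ∣ X ∣ ≤ rank ω x
    ∉Y⇒high x∉Y = ≮⇒≥ (x∉Y ∘ ∈I⁺ ∣ X ∣ ω)

  -- Y ▷ X is impossible: the last element c of Y ─ X lies between the two blocks of
  -- X ─ Y, whose elements have rank ≥ |X| > rank c, so (a) applies to the hook of c.
  not-▷ : ¬ (Y ▷ X)
  not-▷ (Y─X≠∅ , _ , B′ , B″ , B′∪B″≡X─Y , _ , (b′ , b′∈B′) , (b″ , b″∈B″) , around) =
    hook-obstruction ω X c b′ b″ c∉X c-last
      (proj₁ (outer-block (x∈p∪q⁺ (inj₁ b′∈B′)))) (proj₁ between)
      (proj₁ (outer-block (x∈p∪q⁺ (inj₂ b″∈B″)))) (proj₂ (outer-block (x∈p∪q⁺ (inj₂ b″∈B″))))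
      (proj₂ between) (separated (hook ω c) (hook∈C0 ω c))
    where
    last : Σ (Fin n) λ m → m ∈ Y ─ X × (∀ y → y ∈ Y ─ X → toℕ y ≤ toℕ m)
    last = maximise (_∈? (Y ─ X)) toℕ Y─X≠∅
    c : Fin n
    c = proj₁ last
    c∈Y─X : c ∈ Y ─ X
    c∈Y─X = proj₁ (proj₂ last)
    c∉X : c ∉ X
    c∉X = proj₂ (∈─⁻ Y X c∈Y─X)
    rc<∣X∣ : rank ω c < ∣ X ∣
    rc<∣X∣ = ∈I⁻ ∣ X ∣ ω (proj₁ (∈─⁻ Y X c∈Y─X))
    c-last : ∀ x → x ∉ X → rank ω x ≤ rank ω c → toℕ x ≤ toℕ c
    c-last x x∉X rx≤rc = proj₂ (proj₂ last) x (x∈p∧x∉q⇒x∈p─q (∈I⁺ ∣ X ∣ ω (≤-<-trans rx≤rc rc<∣X∣)) x∉X)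
    outer-block : ∀ {b} → b ∈ B′ ∪ B″ → b ∈ X × rank ω c < rank ω b
    outer-block b∈ with ∈─⁻ X Y (subst (_ ∈_) B′∪B″≡X─Y b∈)
    ... | b∈X , b∉Y = b∈X , <-≤-trans rc<∣X∣ (∉Y⇒high b∉Y)
    between : toℕ b′ < toℕ c × toℕ c < toℕ b″
    between = around b′ c b″ b′∈B′ c∈Y─X b″∈B″

  -- If rank c < |X| this is Y ⋖ X itself; otherwise b following c would lie between
  -- an element of Y ─ X and c, and (b) applies to the level of c, which exceeds X.
  precedes : Y ⋖ X → (b c : Fin n) → b ∈ X ─ Y → c ∉ X → rank ω c < rank ω b → toℕ c < toℕ b
  precedes (X─Y≠∅ , before) b c b∈X─Y c∉X rc<rb with rank ω c <? ∣ X ∣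
  ... | yes rc<∣X∣ = before c b (x∈p∧x∉q⇒x∈p─q (∈I⁺ ∣ X ∣ ω rc<∣X∣) c∉X) b∈X─Y
  ... | no rc≮∣X∣ with <-cmp (toℕ c) (toℕ b)
  ...   | tri< c<b _ _ = c<b
  ...   | tri≈ _ c≡b _ = contradiction (subst (_∈ X) (sym (toℕ-injective c≡b)) (proj₁ (∈─⁻ X Y b∈X─Y))) c∉X
  ...   | tri> _ _ b<c = contradiction (separated C (truncated-level∈C0 ω c 1 ≤-refl (s≤s z≤n)))
          (sandwich-obstruction X C a b c a∈C─X b∈X─C c∈C─X (before a b a∈Y─X b∈X─Y) b<c ∣X∣<∣C∣)
    where
    C : Subset n
    C = level ω c ∩ interval 1
    ∈C : ∀ {x} → rank ω x ≤ rank ω c → x ∈ C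
    ∈C rx≤rc = x∈p∩q⁺ (∈I⁺ (suc (rank ω c)) ω (s≤s rx≤rc) , ∈interval⁺ 1 (s≤s z≤n))
    Y─X≠∅ : Nonempty (Y ─ X)
    Y─X≠∅ = equal-size⇒other-difference X Y (sym ∣Y∣≡∣X∣) X─Y≠∅
    a : Fin n
    a = proj₁ Y─X≠∅
    a∈Y─X : a ∈ Y ─ X
    a∈Y─X = proj₂ Y─X≠∅
    a∈C─X : a ∈ C ─ X
    a∈C─X = x∈p∧x∉q⇒x∈p─q
      (∈C (<⇒≤ (<-≤-trans (∈I⁻ ∣ X ∣ ω (proj₁ (∈─⁻ Y X a∈Y─X))) (≮⇒≥ rc≮∣X∣)))) (proj₂ (∈─⁻ Y X a∈Y─X))
    c∈C─X : c ∈ C ─ X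
    c∈C─X = x∈p∧x∉q⇒x∈p─q (∈C ≤-refl) c∉X
    b∈X─C : b ∈ X ─ C
    b∈X─C = x∈p∧x∉q⇒x∈p─q (proj₁ (∈─⁻ X Y b∈X─Y))
      (λ b∈C → <⇒≱ rc<rb (≤-pred (∈I⁻ (suc (rank ω c)) ω (proj₁ (x∈p∩q⁻ (level ω c) (interval 1) b∈C)))))
    ∣X∣<∣C∣ : ∣ X ∣ < ∣ C ∣
    ∣X∣<∣C∣ = subst (∣ X ∣ <_) (sym (trans (cong ∣_∣ (∩interval-1 (level ω c))) (∣level∣ ω c))) (s≤s (≮⇒≥ rc≮∣X∣))

  -- Let b ∈ X ─ Y have the largest rank in X and c be the last non-member of X of
  -- rank below rank b.  A member p of X before c gives (a) for the hook of c (as c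
  -- precedes b); if there is none, X is the level of b truncated after c.
  after-last-low : ¬ InC0 ω X → Y ⋖ X → (b : Fin n) → b ∈ X ─ Y →
    (∀ x → x ∈ X → rank ω x ≤ rank ω b) → (c : Fin n) → c ∉ X → rank ω c < rank ω b →
    (∀ x → x ∉ X → rank ω x < rank ω b → toℕ x ≤ toℕ c) → False
  after-last-low X∉C0 Y⋖X b b∈X─Y b-top c c∉X rc<rb c-last
    with any? (λ x → (x ∈? X) ×-dec (toℕ x <? toℕ c))
  ... | yes (p , p∈X , p<c) =
    hook-obstruction ω X c p b c∉X (λ x x∉X rx≤rc → c-last x x∉X (≤-<-trans rx≤rc rc<rb))
      p∈X p<c (proj₁ (∈─⁻ X Y b∈X─Y)) rc<rb (precedes Y⋖X b c b∈X─Y c∉X rc<rb)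
      (separated (hook ω c) (hook∈C0 ω c))
  ... | no none-before = X∉C0 (level-shaped⇒∈C0 ω X b (suc (toℕ c)) (proj₁ (∈─⁻ X Y b∈X─Y)) b-top
          after-c (λ x x∉X rx<rb → s≤s (c-last x x∉X rx<rb)))
    where
    after-c : ∀ x → x ∈ X → suc (toℕ c) ≤ toℕ x
    after-c x x∈X = ≤∧≢⇒< (≮⇒≥ (λ x<c → none-before (x , x∈X , x<c)))
                          (λ c≡x → c∉X (subst (_∈ X) (sym (toℕ-injective c≡x)) x∈X))

  -- Y ⋖ X is impossible for X ∉ 𝒞⁰: take b ∈ X of largest rank; it lies outside Y.
  -- Without non-members of X of rank below rank b, X is the level of b itself.
  not-⋖ : ¬ InC0 ω X → ¬ (Y ⋖ X)
  not-⋖ X∉C0 Y⋖X@((b₀ , b₀∈X─Y) , _) = below-top (maximise (_∈? X) (rank ω) (b₀ , b₀∈X))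
    where
    b₀∈X : b₀ ∈ X
    b₀∈X = proj₁ (∈─⁻ X Y b₀∈X─Y)
    below-top : (Σ (Fin n) λ b → b ∈ X × (∀ x → x ∈ X → rank ω x ≤ rank ω b)) → False
    below-top (b , b∈X , b-top) with any? (λ x → ¬? (x ∈? X) ×-dec (rank ω x <? rank ω b))
    ... | no no-low = X∉C0 (level-shaped⇒∈C0 ω X b 0 b∈X b-top (λ _ _ → z≤n)
                              (λ x x∉X rx<rb → contradiction (x , x∉X , rx<rb) no-low))
    ... | yes some-low with maximise (λ x → ¬? (x ∈? X) ×-dec (rank ω x <? rank ω b)) toℕ some-low
    ...   | c , (c∉X , rc<rb) , c-last =
      after-last-low X∉C0 Y⋖X b b∈X─Y b-top c c∉X rc<rb (λ x x∉X rx<rb → c-last x (x∉X , rx<rb))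
      where
      b∈X─Y : b ∈ X ─ Y
      b∈X─Y = x∈p∧x∉q⇒x∈p─q b∈X
        (λ b∈Y → <⇒≱ (∈I⁻ ∣ X ∣ ω b∈Y) (≤-trans (∉Y⇒high (proj₂ (∈─⁻ X Y b₀∈X─Y))) (b-top b₀ b₀∈X)))

lemma2p2 : (n : ℕ) (ω : Permutation′ n) (X : Subset n) →
    ¬ InC0 ω X →
    (∀ C → InC0 ω C → WeaklySeparated X C) →
    ¬ (I ∣ X ∣ ω ⋖ X) × ¬ (I ∣ X ∣ ω ▷ X)
lemma2p2 n ω X X∉C0 separated = not-⋖ ω X separated X∉C0 , not-▷ ω X separated
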